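{- Let $n=|Ag|\geq 1$ and $\mathsf{X}\subseteq\{\mathbf{D2},\mathbf{D3},\mathbf{D4},\mathbf{D5}\}$. If a sequent $\Lambda$ is derivable in $\mathsf{G3DS}_{n}\mathsf{X}$, then $\Lambda$ is valid relative to $\mathsf{DS}_{n}\mathsf{X}$.
   Context: Language $\mathcal{L}_n$: $Ag=\{1,\dots,n\}$, $Atm$ countable set of atoms; formulas (negation normal form) $\phi::=p\mid\neg p\mid\phi\lor\phi\mid\phi\land\phi\mid\Box\phi\mid\Diamond\phi\mid[i]\phi\mid\langle i\rangle\phi\mid\otimes_i\phi\mid\ominus_i\phi$. A $\mathsf{DS}_n$-frame is $\langle W,R_\Box,\{R_{[i]}\}_{i\in Ag},\{R_{\otimes_i}\}_{i\in Ag}\rangle$, $W\neq\emptyset$, with: (C1) $R_\Box$ an equivalence relation; (C2) each $R_{[i]}\subseteq R_\Box$ an equivalence relation; (C3) for all $w$ and $u_1,\dots,u_n\in R_\Box(w)$, $\bigcap_i R_{[i]}(u_i)\neq\emptyset$; (D1) $R_\Box wv$ and $R_{\otimes_i}wu$ imply $R_{\otimes_i}vu$. Optional: (D2) each $w$ has an $R_{\otimes_i}$-successor; (D3) $R_{\otimes_i}\subseteq R_\Box$; (D4) $R_{\otimes_i}wv$, $R_{[i]}vu$ imply $R_{\otimes_i}wu$; (D5) each $w$ has $v$ with $R_{\otimes_i}wv$ and $R_{[i]}(v)\subseteq R_{\otimes_i}(w)$. $\mathsf{DS}_n\mathsf{X}$-frames additionally satisfy the properties in $\mathsf{X}$ (for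 all $i$); models add $V:Atm\to\mathcal{P}(W)$; $\Box,[i],\otimes_i$ are interpreted universally and $\Diamond,\langle i\rangle,\ominus_i$ existentially over $R_\Box,R_{[i]},R_{\otimes_i}$; literals, $\land,\lor$ classically. Sequents $\mathcal{R}\vdash\Gamma$: $\mathcal{R}$ a multiset of relational atoms $R_\Box xy,R_{[i]}xy,R_{\otimes_i}xy$, $\Gamma$ a multiset of labelled formulas $x:\phi$. For model $M$ and $I$ from labels to worlds, $M,I\models\mathcal{R}\vdash\Gamma$ iff, whenever all atoms of $\mathcal{R}$ hold under $I$, some $z:\phi\in\Gamma$ has $M,I(z)\Vdash\phi$; valid relative to $\mathsf{DS}_n\mathsf{X}$ means this holds for all $\mathsf{DS}_n\mathsf{X}$-models and all $I$. Paths: $x\sim^{\mathcal{R}}_i y$ iff $x=y$ or $x,y$ are connected by a chain of $R_{[i]}$-atoms of $\mathcal{R}$ taken in either direction; $x\sim^{\mathcal{R}}_\Diamond y$ likewise with $R_\Box$- or any $R_{[j]}$-atoms. Calculus $\mathsf{G3DS}_n$ (premise(s) $\Rightarrow$ conclusion; fresh = not in conclusion): (id) $\mathcal{R}\vdash x:p,x:\neg p,\Gamma$; ($\lor$) $x:\phi,x:\psi\Rightarrow x:\phi\lor\psi$; ($\land$) two premises $x:\phi$, $x:\psi\Rightarrow x:\phi\land\psi$; ($\Box$) $\mathcal{R},R_\Box xy\vdash y:\phi,\Gamma\Rightarrow\mathcal{R}\vdash x:\Box\phi,\Gamma$, $y$ fresh; ($\Diamond$) $\mathcal{R}\vdash x:\Diamond\phi,y:\phi,\Gamma\Rightarrow\mathcal{R}\vdash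 x:\Diamond\phi,\Gamma$ if $x\sim^{\mathcal{R}}_\Diamond y$; ($[i]$) analogous to ($\Box$) with $R_{[i]}$; ($\langle i\rangle$) analogous to ($\Diamond$) with condition $x\sim^{\mathcal{R}}_i y$; ($\otimes_i$) analogous to ($\Box$) with $R_{\otimes_i}$; ($\ominus_i$) $\mathcal{R},R_{\otimes_i}xy\vdash x:\ominus_i\phi,y:\phi,\Gamma\Rightarrow\mathcal{R},R_{\otimes_i}xy\vdash x:\ominus_i\phi,\Gamma$; (IOA) $\mathcal{R},R_{[1]}x_1y,\dots,R_{[n]}x_ny\vdash\Gamma\Rightarrow\mathcal{R}\vdash\Gamma$, $y$ fresh, $x_j\sim^{\mathcal{R}}_\Diamond x_{j+1}$ for all $j$; (D1$_i$) $\mathcal{R},R_{\otimes_i}xz,R_{\otimes_i}yz\vdash\Gamma\Rightarrow\mathcal{R},R_{\otimes_i}xz\vdash\Gamma$ if $x\sim^{\mathcal{R}}_\Diamond y$. Extra rules: (D2$_i$) $\mathcal{R},R_{\otimes_i}xy\vdash\Gamma\Rightarrow\mathcal{R}\vdash\Gamma$, $y$ fresh; (D3$_i$) $\mathcal{R},R_{\otimes_i}xy,R_\Box xy\vdash\Gamma\Rightarrow\mathcal{R},R_{\otimes_i}xy\vdash\Gamma$; (D4$_i$) $\mathcal{R},R_{\otimes_i}xy,R_{\otimes_i}xz\vdash\Gamma\Rightarrow\mathcal{R},R_{\otimes_i}xy\vdash\Gamma$ if $y\sim^{\mathcal{R}}_i z$; (D5$_i$) the system of (D5$^1_i$) $\mathcal{R},R_{\otimes_i}xy\vdash\Gamma\Rightarrow\mathcal{R}\vdash\Gamma$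 ($y$ fresh) and (D5$^2_i$) $\mathcal{R}',R_{\otimes_i}xz\vdash\Gamma'\Rightarrow\mathcal{R}'\vdash\Gamma'$ where $y\sim^{\mathcal{R}'}_i z$ and $R_{\otimes_i}xy$ was introduced by an application of (D5$^1_i$) further down in the derivation. $\mathsf{G3DS}_n\mathsf{X}$ is $\mathsf{G3DS}_n$ plus (D$K_i$) for all $i$ whenever $\mathbf{D}K\in\mathsf{X}$. Derivations are finite trees with (id) leaves. -}

module Defs where

open import Data.Nat using (ℕ; suc)
open import Data.Fin using (Fin; toℕ)
open import Data.Bool using (Bool; T)
open import Data.List using (List; []; _∷_; _++_; tabulate; concatMap)
open import Data.List.Membership.Propositional using (_∈_; _∉_)
open import Data.List.Relation.Unary.Any using (Any)
open import Data.List.Relation.Unary.All using (All)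
open import Data.List.Relation.Binary.Permutation.Propositional using (_↭_)
open import Data.Product using (Σ; _×_; _,_)
open import Data.Sum using (_⊎_)
open import Relation.Nullary using (¬_)
open import Relation.Binary.PropositionalEquality using (_≡_)

Atm : Set
Atm = ℕ

Label : Set
Label = ℕ

infixr 6 _∧'_
infixr 5 _∨'_

-- formulas of L_n in negation normal form
data Fm (n : ℕ) : Set where
  atom  : Atm → Fm n
  natom : Atm → Fm n
  _∨'_  : Fm n → Fm n → Fm n
  _∧'_  : Fm n → Fm n → Fm n
  □     : Fm n → Fm n
  ◇     : Fm n → Fm n
  [_]   : Fin n → Fm n → Fm n
  ⟨_⟩   : Fin n → Fm n → Fm n
  ⊗[_]  : Fin n → Fm n → Fm n
  ⊖[_]  : Fin n → Fm n → Fm n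

data RelAtom (n : ℕ) : Set where
  rBox : Label → Label → RelAtom n
  rAg  : Fin n → Label → Label → RelAtom n
  rOb  : Fin n → Label → Label → RelAtom n

LFm : ℕ → Set
LFm n = Label × Fm n

labelsR : ∀ {n} → List (RelAtom n) → List Label
labelsR = concatMap f
  where
  f : ∀ {n} → RelAtom n → List Label
  f (rBox x y)  = x ∷ y ∷ []
  f (rAg _ x y) = x ∷ y ∷ []
  f (rOb _ x y) = x ∷ y ∷ []

labelsΓ : ∀ {n} → List (LFm n) → List Label
labelsΓ = concatMap (λ { (x , _) → x ∷ [] })

Fresh : ∀ {n} → Label → List (RelAtom n) → List (LFm n) → Set
Fresh y R Γ = (y ∉ labelsR R) × (y ∉ labelsΓ Γ)

data Path {n : ℕ} (E : RelAtom n → Label → Label → Set)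
          (R : List (RelAtom n)) : Label → Label → Set where
  here : ∀ {x} → Path E R x x
  fwd  : ∀ {x y z a} → a ∈ R → E a x y → Path E R y z → Path E R x z
  bwd  : ∀ {x y z a} → a ∈ R → E a y x → Path E R y z → Path E R x z

data AgEdge {n : ℕ} (i : Fin n) : RelAtom n → Label → Label → Set where
  ag : ∀ {x y} → AgEdge i (rAg i x y) x y

data DiaEdge {n : ℕ} : RelAtom n → Label → Label → Set where
  bx : ∀ {x y} → DiaEdge (rBox x y) x y
  ag : ∀ {j x y} → DiaEdge (rAg j x y) x y

AgPath : ∀ {n} → Fin n → List (RelAtom n) → Label → Label → Set
AgPath i = Path (AgEdge i)

DiaPath : ∀ {n} → List (RelAtom n) → Label → Label → Set
DiaPath = Path DiaEdge

data Ext : Set where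
  D2 D3 D4 D5 : Ext

-- Der X D R Γ : the sequent R ⊢ Γ is derivable, where D lists the
-- atoms R_⊗i x y (as (i , x , y)) introduced by (D5¹_i) further down
-- the current branch (needed for the side condition of (D5²_i)).
-- Sequents are multisets; this is modelled by lists together with the
-- rule 'exch' (multiset equality = permutation).

data Der {n : ℕ} (X : Ext → Bool) :
     List (Fin n × Label × Label) → List (RelAtom n) → List (LFm n) → Set where
  exch : ∀ {D R R' Γ Γ'} → R ↭ R' → Γ ↭ Γ' → Der X D R Γ → Der X D R' Γ'
  id   : ∀ {D R Γ x p} → Der X D R ((x , atom p) ∷ (x , natom p) ∷ Γ)
  ∨R   : ∀ {D R Γ x φ ψ} →
         Der X D R ((x , φ) ∷ (x , ψ) ∷ Γ) →
         Der X D R ((x , φ ∨' ψ) ∷ Γ)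
  ∧R   : ∀ {D R Γ x φ ψ} →
         Der X D R ((x , φ) ∷ Γ) → Der X D R ((x , ψ) ∷ Γ) →
         Der X D R ((x , φ ∧' ψ) ∷ Γ)
  □R   : ∀ {D R Γ x y φ} → Fresh y R ((x , □ φ) ∷ Γ) →
         Der X D (rBox x y ∷ R) ((y , φ) ∷ Γ) →
         Der X D R ((x , □ φ) ∷ Γ)
  ◇R   : ∀ {D R Γ x y φ} → DiaPath R x y →
         Der X D R ((x , ◇ φ) ∷ (y , φ) ∷ Γ) →
         Der X D R ((x , ◇ φ) ∷ Γ)
  []R  : ∀ {D R Γ x y φ i} → Fresh y R ((x , [ i ] φ) ∷ Γ) →
         Der X D (rAg i x y ∷ R) ((y , φ) ∷ Γ) →
         Der X D R ((x , [ i ] φ) ∷ Γ)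
  ⟨⟩R  : ∀ {D R Γ x y φ i} → AgPath i R x y →
         Der X D R ((x , ⟨ i ⟩ φ) ∷ (y , φ) ∷ Γ) →
         Der X D R ((x , ⟨ i ⟩ φ) ∷ Γ)
  ⊗R   : ∀ {D R Γ x y φ i} → Fresh y R ((x , ⊗[ i ] φ) ∷ Γ) →
         Der X D (rOb i x y ∷ R) ((y , φ) ∷ Γ) →
         Der X D R ((x , ⊗[ i ] φ) ∷ Γ)
  ⊖R   : ∀ {D R Γ x y φ i} →
         Der X D (rOb i x y ∷ R) ((x , ⊖[ i ] φ) ∷ (y , φ) ∷ Γ) →
         Der X D (rOb i x y ∷ R) ((x , ⊖[ i ] φ) ∷ Γ)
  IOA  : ∀ {D R Γ y} (xs : Fin n → Label) → Fresh y R Γ →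
         (∀ (j k : Fin n) → toℕ k ≡ suc (toℕ j) → DiaPath R (xs j) (xs k)) →
         Der X D (tabulate (λ i → rAg i (xs i) y) ++ R) Γ →
         Der X D R Γ
  D1R  : ∀ {D R Γ x y z i} → DiaPath R x y →
         Der X D (rOb i x z ∷ rOb i y z ∷ R) Γ →
         Der X D (rOb i x z ∷ R) Γ
  D2R  : ∀ {D R Γ x y i} → T (X D2) → Fresh y R Γ →
         Der X D (rOb i x y ∷ R) Γ →
         Der X D R Γ
  D3R  : ∀ {D R Γ x y i} → T (X D3) →
         Der X D (rOb i x y ∷ rBox x y ∷ R) Γ →
         Der X D (rOb i x y ∷ R) Γ
  D4R  : ∀ {D R Γ x y z i} → T (X D4) → AgPath i R y z →
         Der X D (rOb i x y ∷ rOb i x z ∷ R) Γ →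
         Der X D (rOb i x y ∷ R) Γ
  D5¹R : ∀ {D R Γ x y i} → T (X D5) → Fresh y R Γ →
         Der X ((i , x , y) ∷ D) (rOb i x y ∷ R) Γ →
         Der X D R Γ
  D5²R : ∀ {D R Γ x y z i} → T (X D5) → (i , x , y) ∈ D →
         AgPath i R y z →
         Der X D (rOb i x z ∷ R) Γ →
         Der X D R Γ

-- derivable (no pending D5¹ atoms at the root)
Derivable : ∀ {n} → (Ext → Bool) → List (RelAtom n) → List (LFm n) → Set
Derivable X R Γ = Der X [] R Γ

record Frame (n : ℕ) : Set₁ where
  field
    W   : Set
    RB  : W → W → Set
    RA  : Fin n → W → W → Set
    RO  : Fin n → W → W → Set

record IsEquiv {W : Set} (R : W → W → Set) : Set where
  field
    refl  : ∀ w → R w w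
    sym   : ∀ {w v} → R w v → R v w
    trans : ∀ {w v u} → R w v → R v u → R w u

record IsDS {n : ℕ} (F : Frame n) : Set where
  open Frame F
  field
    C1  : IsEquiv RB
    C2a : ∀ i → IsEquiv (RA i)
    C2b : ∀ i {w v} → RA i w v → RB w v
    C3  : ∀ w (u : Fin n → W) → (∀ i → RB w (u i)) →
          Σ W (λ v → ∀ i → RA i (u i) v)
    D1  : ∀ i {w v u} → RB w v → RO i w u → RO i v u

ExtCond : ∀ {n} → Ext → Frame n → Set
ExtCond D2 F = ∀ i w → Σ W (λ v → RO i w v)            where open Frame F
ExtCond D3 F = ∀ i {w v} → RO i w v → RB w v           where open Frame F
ExtCond D4 F = ∀ i {w v u} → RO i w v → RA i v u → RO i w u  where open Frame F
ExtCond D5 F = ∀ i w → Σ W (λ v → RO i w v × (∀ u → RA i v u → RO i w u))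
  where open Frame F

IsDSX : ∀ {n} → (Ext → Bool) → Frame n → Set
IsDSX X F = IsDS F × (∀ k → T (X k) → ExtCond k F)

forces : ∀ {n} (F : Frame n) → (Atm → Frame.W F → Set) → Frame.W F → Fm n → Set
forces F V w (atom p)    = V p w
forces F V w (natom p)   = ¬ V p w
forces F V w (φ ∨' ψ)    = forces F V w φ ⊎ forces F V w ψ
forces F V w (φ ∧' ψ)    = forces F V w φ × forces F V w ψ
forces F V w (□ φ)       = ∀ v → Frame.RB F w v → forces F V v φ
forces F V w (◇ φ)       = Σ (Frame.W F) (λ v → Frame.RB F w v × forces F V v φ)
forces F V w ([ i ] φ)   = ∀ v → Frame.RA F i w v → forces F V v φ
forces F V w (⟨ i ⟩ φ)   = Σ (Frame.W F) (λ v → Frame.RA F i w v × forces F V v φ)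
forces F V w (⊗[ i ] φ)  = ∀ v → Frame.RO F i w v → forces F V v φ
forces F V w (⊖[ i ] φ)  = Σ (Frame.W F) (λ v → Frame.RO F i w v × forces F V v φ)

holds : ∀ {n} (F : Frame n) → (Label → Frame.W F) → RelAtom n → Set
holds F I (rBox x y)  = Frame.RB F (I x) (I y)
holds F I (rAg i x y) = Frame.RA F i (I x) (I y)
holds F I (rOb i x y) = Frame.RO F i (I x) (I y)

SatSeq : ∀ {n} (F : Frame n) → (Atm → Frame.W F → Set) → (Label → Frame.W F) →
         List (RelAtom n) → List (LFm n) → Set
SatSeq F V I R Γ = All (holds F I) R →
                   Any (λ xφ → forces F V (I (Data.Product.proj₁ xφ)) (Data.Product.proj₂ xφ)) Γ

Valid : ∀ {n} → (Ext → Bool) → List (RelAtom n) → List (LFm n) → Set₁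
Valid {n} X R Γ = (F : Frame n) → IsDSX X F →
                  (V : Atm → Frame.W F → Set) → (I : Label → Frame.W F) →
                  SatSeq F V I R Γ

{-# OPTIONS --safe #-}
module Submission where

-- Soundness is proved rule by rule, by induction on derivations, for every model and every
-- interpretation of labels at once: a rule introducing a fresh label y is justified by
-- re-interpreting y, which affects nothing else in the sequent, and the relational rules by
-- the corresponding frame conditions (C3 for IOA, D1-D5 for the rules D1-D5).
-- Two points need care. The side condition of (D5²) refers to atoms introduced by (D5¹)
-- lower in the branch, so the induction hypothesis also assumes that each such atom
-- R_⊗i x y is interpreted as in (D5): R_[i](I y) ⊆ R_⊗i(I x).
-- And the fresh label y of (D2)/(D5¹) may coincide with x; the atom R_⊗i x x then needs a
-- world that is its own ⊗_i-successor, which is supplied by adjoining a one-point frame: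
-- DS_nX-frames are closed under disjoint unions, and forcing at the old worlds is unchanged.

open import Defs
open import Data.Nat using (ℕ; suc; _≟_)
open import Data.Bool using (Bool; T)
open import Data.List using (List; []; _∷_; tabulate)
open import Level using (0ℓ)
open import Axiom.ExcludedMiddle using (ExcludedMiddle)
open import Data.Fin using (Fin; inject₁) renaming (zero to fzero; suc to fsuc)
open import Data.Fin.Properties using (toℕ-inject₁)
open import Data.Fin.Induction using (<-weakInduction)
open import Data.Unit using (⊤; tt)
open import Data.Empty using (⊥; ⊥-elim)
open import Data.Product using (Σ; _×_; _,_; proj₁; proj₂)
open import Data.Sum using (_⊎_; inj₁; inj₂; [_,_]′)
open import Data.Sum.Relation.Binary.Pointwise using (Pointwise; inj₁; inj₂; ⊎-symmetric; ⊎-transitive; ⊎-reflexive)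
open import Function using (_∘_)
open import Relation.Nullary using (yes; no)
open import Relation.Binary.Definitions using (Reflexive; Transitive)
open import Relation.Binary.PropositionalEquality using (_≡_; _≢_; refl; sym; cong; subst; subst₂)
open import Data.List.Membership.Propositional using (_∈_; _∉_)
open import Data.List.Membership.Propositional.Properties using (∈-++⁺ʳ; ∈-concatMap⁺)
open import Data.List.Relation.Binary.Subset.Propositional using (_⊆_)
open import Data.List.Relation.Binary.Subset.Propositional.Properties using (xs⊆x∷xs; ∷⁺ʳ)
open import Data.List.Relation.Unary.Any using (Any; here; there; toSum)
import Data.List.Relation.Unary.Any as Any
open import Data.List.Relation.Unary.All using (All; []; _∷_; lookup)
import Data.List.Relation.Unary.All as All
open import Data.List.Relation.Unary.All.Properties using (++⁺; tabulate⁺)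
open import Data.List.Relation.Binary.Permutation.Propositional using (↭-sym)
open import Data.List.Relation.Binary.Permutation.Propositional.Properties using (All-resp-↭; Any-resp-↭; ∈-resp-↭)

-- Opaque, so that update I y v z is a rigid term that unification can match.
opaque
  update : {A : Set} → (Label → A) → Label → A → Label → A
  update I y v z with z ≟ y
  ... | yes _ = v
  ... | no _ = I z

  update-≡ : ∀ {A : Set} {I : Label → A} {y v} → update I y v y ≡ v
  update-≡ {y = y} with y ≟ y
  ... | yes _ = refl
  ... | no y≢y = ⊥-elim (y≢y refl)

  update-≢ : ∀ {A : Set} {I : Label → A} {y v z} → z ≢ y → update I y v z ≡ I z
  update-≢ {y = y} {z = z} z≢y with z ≟ y
  ... | yes z≡y = ⊥-elim (z≢y z≡y)
  ... | no _ = refl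

module _ {A : Set} {I : Label → A} {y : Label} {v : A} {Rel : A → A → Set} where

  update-rel : ∀ {x} → x ≢ y → Rel (I x) v → Rel (update I y v x) (update I y v y)
  update-rel x≢y = subst₂ Rel (sym (update-≢ x≢y)) (sym update-≡)

  update-rel-loop : Rel v v → Rel (update I y v y) (update I y v y)
  update-rel-loop = subst (λ w → Rel w w) (sym update-≡)

  update-rel-reflexive : ∀ {x} → (∀ w → Rel w w) → Rel (I x) v →
                         Rel (update I y v x) (update I y v y)
  update-rel-reflexive {x} rel-refl r with x ≟ y
  ... | yes refl = update-rel-loop (rel-refl v)
  ... | no x≢y = update-rel x≢y r

_≗_on_ : {A : Set} → (Label → A) → (Label → A) → List Label → Set
I ≗ J on L = ∀ {z} → z ∈ L → I z ≡ J z

update-agrees : ∀ {A : Set} {I : Label → A} {y v L} → y ∉ L → I ≗ update I y v on L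
update-agrees y∉L z∈L = sym (update-≢ (λ { refl → y∉L z∈L }))

∉-∷⇒≢ : ∀ {x y : Label} {L} → y ∉ x ∷ L → x ≢ y
∉-∷⇒≢ y∉ refl = y∉ (here refl)

∈-labelsR : ∀ {n} {R : List (RelAtom n)} {i x y} → rOb i x y ∈ R →
            x ∈ labelsR R × y ∈ labelsR R
∈-labelsR mem = ∈-concatMap⁺ _ (Any.map (λ { refl → here refl }) mem)
              , ∈-concatMap⁺ _ (Any.map (λ { refl → there (here refl) }) mem)

Recorded : ∀ {n} → List (Fin n × Label × Label) → List (RelAtom n) → Set
Recorded D R = ∀ {i x y} → (i , x , y) ∈ D → rOb i x y ∈ R

Recorded-⊆ : ∀ {n} {D} {R R' : List (RelAtom n)} → R ⊆ R' → Recorded D R → Recorded D R'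
Recorded-⊆ R⊆R' rec mem = R⊆R' (rec mem)

Recorded-∷ : ∀ {n} {D} {R : List (RelAtom n)} {i x y} →
             Recorded D R → Recorded ((i , x , y) ∷ D) (rOb i x y ∷ R)
Recorded-∷ rec (here refl) = here refl
Recorded-∷ rec (there mem) = there (rec mem)

Any-absorb : ∀ {A : Set} {P : A → Set} {a b L} → (P b → P a) → Any P (a ∷ b ∷ L) → Any P (a ∷ L)
Any-absorb f (here pa) = here pa
Any-absorb f (there (here pb)) = here (f pb)
Any-absorb f (there (there pL)) = there pL

consecutive⇒from-zero : ∀ {k} {A : Set} {P : A → A → Set} → Reflexive P → Transitive P →
                        (g : Fin (suc k) → A) → (∀ i → P (g (inject₁ i)) (g (fsuc i))) →
                        ∀ l → P (g fzero) (g l)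
consecutive⇒from-zero {P = P} p-refl p-trans g step =
  <-weakInduction (λ l → P (g fzero) (g l)) p-refl (λ i p → p-trans p (step i))

module _ {n} (F : Frame n) where
  open Frame F

  Forced : (Atm → W → Set) → (Label → W) → LFm n → Set
  Forced V I xφ = forces F V (I (proj₁ xφ)) (proj₂ xφ)

  D5Witness : Fin n → W → W → Set
  D5Witness i w v = ∀ u → RA i v u → RO i w u

  Witnesses : (Label → W) → List (Fin n × Label × Label) → Set
  Witnesses I D = ∀ {i x y} → (i , x , y) ∈ D → D5Witness i (I x) (I y)

  Witnesses-∷ : ∀ {I D i x y} → D5Witness i (I x) (I y) → Witnesses I D →
                Witnesses I ((i , x , y) ∷ D)
  Witnesses-∷ w wit (here refl) = w
  Witnesses-∷ w wit (there mem) = wit mem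

  Sat : (Atm → W → Set) → (Label → W) →
        List (Fin n × Label × Label) → List (RelAtom n) → List (LFm n) → Set
  Sat V I D R Γ = Witnesses I D → SatSeq F V I R Γ

  All-holds-≗ : ∀ {I J} R → I ≗ J on labelsR R → All (holds F I) R → All (holds F J) R
  All-holds-≗ [] I≗J [] = []
  All-holds-≗ (rBox x y ∷ R) I≗J (h ∷ hs) =
    subst₂ RB (I≗J (here refl)) (I≗J (there (here refl))) h
    ∷ All-holds-≗ R (I≗J ∘ there ∘ there) hs
  All-holds-≗ (rAg i x y ∷ R) I≗J (h ∷ hs) =
    subst₂ (RA i) (I≗J (here refl)) (I≗J (there (here refl))) h
    ∷ All-holds-≗ R (I≗J ∘ there ∘ there) hs
  All-holds-≗ (rOb i x y ∷ R) I≗J (h ∷ hs) =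
    subst₂ (RO i) (I≗J (here refl)) (I≗J (there (here refl))) h
    ∷ All-holds-≗ R (I≗J ∘ there ∘ there) hs

  Any-forces-≗ : ∀ {V I J} Γ → I ≗ J on labelsΓ Γ → Any (Forced V I) Γ → Any (Forced V J) Γ
  Any-forces-≗ {V} ((x , φ) ∷ Γ) I≗J (here f) =
    here (subst (λ w → forces F V w φ) (I≗J (here refl)) f)
  Any-forces-≗ ((x , φ) ∷ Γ) I≗J (there γ) = there (Any-forces-≗ Γ (I≗J ∘ there) γ)

  Witnesses-≗ : ∀ {I J D R} → Recorded D R → I ≗ J on labelsR R → Witnesses I D → Witnesses J D
  Witnesses-≗ rec I≗J wit mem u r =
    let x∈R , y∈R = ∈-labelsR (rec mem)
    in subst (λ w → RO _ w u) (I≗J x∈R) (wit mem u (subst (λ w → RA _ w u) (sym (I≗J y∈R)) r))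

  update-fresh : ∀ {V I y v D R Γ} → Fresh y R Γ → Recorded D R →
                 Sat V (update I y v) D R Γ → Sat V I D R Γ
  update-fresh {Γ = Γ} (y∉R , y∉Γ) rec sat wit hs =
    Any-forces-≗ Γ (sym ∘ update-agrees y∉Γ)
      (sat (Witnesses-≗ rec (update-agrees y∉R) wit) (All-holds-≗ _ (update-agrees y∉R) hs))

  path-sound : ∀ {I E R x y} (Rel : W → W → Set) → IsEquiv Rel →
               (∀ {a x y} → E a x y → holds F I a → Rel (I x) (I y)) →
               All (holds F I) R → Path E R x y → Rel (I x) (I y)
  path-sound Rel equiv edge hs here = IsEquiv.refl equiv _
  path-sound Rel equiv edge hs (fwd a∈R e p) =
    IsEquiv.trans equiv (edge e (lookup hs a∈R)) (path-sound Rel equiv edge hs p)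
  path-sound Rel equiv edge hs (bwd a∈R e p) =
    IsEquiv.trans equiv (IsEquiv.sym equiv (edge e (lookup hs a∈R))) (path-sound Rel equiv edge hs p)

  module _ (ds : IsDS F) where
    open IsDS ds

    DiaPath⇒RB : ∀ {I R x y} → All (holds F I) R → DiaPath R x y → RB (I x) (I y)
    DiaPath⇒RB = path-sound RB C1 λ { bx h → h ; (ag {j}) h → C2b j h }

    AgPath⇒RA : ∀ {I R x y i} → All (holds F I) R → AgPath i R x y → RA i (I x) (I y)
    AgPath⇒RA {i = i} = path-sound (RA i) (C2a i) λ { ag h → h }

module _ {k} {F : Frame (suc k)} (ds : IsDS F) where
  open Frame F
  open IsDS ds

  chain-meet : (u : Fin (suc k) → W) → (∀ i → RB (u (inject₁ i)) (u (fsuc i))) →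
               Σ W λ v → ∀ i → RA i (u i) v
  chain-meet u step =
    C3 (u fzero) u (consecutive⇒from-zero (λ {w} → IsEquiv.refl C1 w) (IsEquiv.trans C1) u step)

_⊎ᶠ_ : ∀ {n} → Frame n → Frame n → Frame n
F ⊎ᶠ G = record
  { W  = F.W ⊎ G.W
  ; RB = Pointwise F.RB G.RB
  ; RA = λ i → Pointwise (F.RA i) (G.RA i)
  ; RO = λ i → Pointwise (F.RO i) (G.RO i)
  }
  where
  module F = Frame F
  module G = Frame G

module _ {A B : Set} {R : A → A → Set} {S : B → B → Set} where

  IsEquiv-⊎ : IsEquiv R → IsEquiv S → IsEquiv (Pointwise R S)
  IsEquiv-⊎ eR eS = record
    { refl  = λ { (inj₁ a) → inj₁ (IsEquiv.refl eR a) ; (inj₂ b) → inj₂ (IsEquiv.refl eS b) }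
    ; sym   = ⊎-symmetric (IsEquiv.sym eR) (IsEquiv.sym eS)
    ; trans = ⊎-transitive (IsEquiv.trans eR) (IsEquiv.trans eS)
    }

  module _ {T : A → A → Set} {U : B → B → Set} where

    inj₁-related : ∀ {a s} → Pointwise R S (inj₁ a) s →
                   Σ A λ b → R a b × (∀ {c} → T b c → Pointwise T U s (inj₁ c))
    inj₁-related (inj₁ r) = _ , r , inj₁

    inj₂-related : ∀ {b s} → Pointwise R S (inj₂ b) s →
                   Σ B λ c → S b c × (∀ {d} → U c d → Pointwise T U s (inj₂ d))
    inj₂-related (inj₂ r) = _ , r , inj₂

module _ {n} {F G : Frame n} where
  private
    module F = Frame F
    module G = Frame G
  open Frame (F ⊎ᶠ G)

  C3-⊎ : IsDS F → IsDS G → ∀ w (u : Fin n → W) → (∀ i → RB w (u i)) →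
         Σ W (λ v → ∀ i → RA i (u i) v)
  C3-⊎ dsF dsG (inj₁ a) u h =
    let v , meet = IsDS.C3 dsF a (proj₁ ∘ related) (proj₁ ∘ proj₂ ∘ related)
    in inj₁ v , λ i → proj₂ (proj₂ (related i)) (meet i)
    where related = λ i → inj₁-related (h i)
  C3-⊎ dsF dsG (inj₂ b) u h =
    let v , meet = IsDS.C3 dsG b (proj₁ ∘ related) (proj₁ ∘ proj₂ ∘ related)
    in inj₂ v , λ i → proj₂ (proj₂ (related i)) (meet i)
    where related = λ i → inj₂-related (h i)

  IsDS-⊎ : IsDS F → IsDS G → IsDS (F ⊎ᶠ G)
  IsDS-⊎ dsF dsG = record
    { C1  = IsEquiv-⊎ (IsDS.C1 dsF) (IsDS.C1 dsG)
    ; C2a = λ i → IsEquiv-⊎ (IsDS.C2a dsF i) (IsDS.C2a dsG i)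
    ; C2b = λ i → ⊎-reflexive (IsDS.C2b dsF i) (IsDS.C2b dsG i)
    ; C3  = C3-⊎ dsF dsG
    ; D1  = λ i → λ { (inj₁ p) (inj₁ q) → inj₁ (IsDS.D1 dsF i p q)
                    ; (inj₂ p) (inj₂ q) → inj₂ (IsDS.D1 dsG i p q) }
    }

  ExtCond-⊎ : ∀ k → ExtCond k F → ExtCond k G → ExtCond k (F ⊎ᶠ G)
  ExtCond-⊎ D2 eF eG i (inj₁ w) = let v , r = eF i w in inj₁ v , inj₁ r
  ExtCond-⊎ D2 eF eG i (inj₂ w) = let v , r = eG i w in inj₂ v , inj₂ r
  ExtCond-⊎ D3 eF eG i = ⊎-reflexive (eF i) (eG i)
  ExtCond-⊎ D4 eF eG i (inj₁ p) (inj₁ q) = inj₁ (eF i p q)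
  ExtCond-⊎ D4 eF eG i (inj₂ p) (inj₂ q) = inj₂ (eG i p q)
  ExtCond-⊎ D5 eF eG i (inj₁ w) =
    let v , r , cl = eF i w in inj₁ v , inj₁ r , λ { _ (inj₁ q) → inj₁ (cl _ q) }
  ExtCond-⊎ D5 eF eG i (inj₂ w) =
    let v , r , cl = eG i w in inj₂ v , inj₂ r , λ { _ (inj₂ q) → inj₂ (cl _ q) }

  IsDSX-⊎ : ∀ {X} → IsDSX X F → IsDSX X G → IsDSX X (F ⊎ᶠ G)
  IsDSX-⊎ (dsF , extF) (dsG , extG) = IsDS-⊎ dsF dsG , λ k t → ExtCond-⊎ k (extF k t) (extG k t)

  module _ {V : Atm → F.W → Set} {V' : Atm → G.W → Set} where
    private
      V⊎ : Atm → W → Set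
      V⊎ p = [ V p , V' p ]′

    forces-inj₁ : ∀ w φ → forces (F ⊎ᶠ G) V⊎ (inj₁ w) φ → forces F V w φ
    forces-inj₁ w (atom p) h = h
    forces-inj₁ w (natom p) h = h
    forces-inj₁ w (φ ∨' ψ) (inj₁ h) = inj₁ (forces-inj₁ w φ h)
    forces-inj₁ w (φ ∨' ψ) (inj₂ h) = inj₂ (forces-inj₁ w ψ h)
    forces-inj₁ w (φ ∧' ψ) (h , g) = forces-inj₁ w φ h , forces-inj₁ w ψ g
    forces-inj₁ w (□ φ) h v r = forces-inj₁ v φ (h (inj₁ v) (inj₁ r))
    forces-inj₁ w ([ i ] φ) h v r = forces-inj₁ v φ (h (inj₁ v) (inj₁ r))
    forces-inj₁ w (⊗[ i ] φ) h v r = forces-inj₁ v φ (h (inj₁ v) (inj₁ r))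
    forces-inj₁ w (◇ φ) (inj₁ v , inj₁ r , h) = v , r , forces-inj₁ v φ h
    forces-inj₁ w (⟨ i ⟩ φ) (inj₁ v , inj₁ r , h) = v , r , forces-inj₁ v φ h
    forces-inj₁ w (⊖[ i ] φ) (inj₁ v , inj₁ r , h) = v , r , forces-inj₁ v φ h

    holds-inj₁ : ∀ {I : Label → F.W} a → holds F I a → holds (F ⊎ᶠ G) (inj₁ ∘ I) a
    holds-inj₁ (rBox x y) = inj₁
    holds-inj₁ (rAg i x y) = inj₁
    holds-inj₁ (rOb i x y) = inj₁

    Witnesses-inj₁ : ∀ {I : Label → F.W} {D} →
                     Witnesses F I D → Witnesses (F ⊎ᶠ G) (inj₁ ∘ I) D
    Witnesses-inj₁ wit mem (inj₁ u) (inj₁ r) = inj₁ (wit mem u r)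

    Sat-inj₁ : ∀ {I : Label → F.W} {D R Γ} →
               Sat (F ⊎ᶠ G) V⊎ (inj₁ ∘ I) D R Γ → Sat F V I D R Γ
    Sat-inj₁ {I} sat wit hs =
      Any.map (λ {xφ} → forces-inj₁ (I (proj₁ xφ)) (proj₂ xφ))
        (sat (Witnesses-inj₁ wit) (All.map (λ {a} → holds-inj₁ a) hs))

pointFrame : ∀ {n} → Frame n
pointFrame = record { W = ⊤ ; RB = λ _ _ → ⊤ ; RA = λ _ _ _ → ⊤ ; RO = λ _ _ _ → ⊤ }

pointFrame-isDSX : ∀ {n} X → IsDSX X (pointFrame {n})
pointFrame-isDSX X = _ , extCond
  where
  extCond : ∀ k → T (X k) → ExtCond k pointFrame
  extCond D2 _ = _
  extCond D3 _ = _
  extCond D4 _ = _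
  extCond D5 _ = _

module Soundness (em : ExcludedMiddle 0ℓ) {m : ℕ} (X : Ext → Bool) where
  n = suc m

  Sound : List (Fin n × Label × Label) → List (RelAtom n) → List (LFm n) → Set₁
  Sound D R Γ = (F : Frame n) → IsDSX X F → ∀ V I → Sat F V I D R Γ

  -- Excluded middle on Γ: only once Γ is known to fail does every successor world yield φ.
  box-sound : ∀ {D R Γ x y φ ψ} (Rel : (F : Frame n) → Frame.W F → Frame.W F → Set)
              (edge : Label → Label → RelAtom n) →
              (∀ {F} {I : Label → Frame.W F} → Rel F (I x) (I y) → holds F I (edge x y)) →
              (∀ {F V w} → (∀ v → Rel F w v → forces F V v φ) → forces F V w ψ) →
              Fresh y R ((x , ψ) ∷ Γ) → Recorded D R →
              Sound D (edge x y ∷ R) ((y , φ) ∷ Γ) → Sound D R ((x , ψ) ∷ Γ)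
  box-sound {R = R} {Γ} {x} {y} {φ} Rel edge intro-edge intro-box (y∉R , y∉Γ) rec premise
            F fx V I wit hs
    with em {Any (Forced F V I) Γ}
  ... | yes γ = there γ
  ... | no ¬γ = here (intro-box λ v r →
    [ subst (λ w → forces F V w φ) update-≡
    , ⊥-elim ∘ ¬γ ∘ Any-forces-≗ F Γ (sym ∘ update-agrees (y∉Γ ∘ there))
    ]′ (toSum (premise F fx V (update I y v) (Witnesses-≗ F rec (update-agrees y∉R) wit)
                 (intro-edge (update-rel {Rel = Rel F} (∉-∷⇒≢ y∉Γ) r)
                  ∷ All-holds-≗ F R (update-agrees y∉R) hs))))

  point-successor : ∀ {D R Γ x i} → Fresh x R Γ → Recorded D R →
                    Sound ((i , x , x) ∷ D) (rOb i x x ∷ R) Γ → Sound D R Γ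
  point-successor {x = x} {i} fresh rec premise F fx V I =
    Sat-inj₁ (update-fresh F⁺ fresh rec λ wit hs →
      premise F⁺ (IsDSX-⊎ fx (pointFrame-isDSX X)) V⁺ (update (inj₁ ∘ I) x (inj₂ tt))
        (Witnesses-∷ F⁺ (update-rel-loop {Rel = D5Witness F⁺ i} point-witness) wit)
        (update-rel-loop {Rel = Frame.RO F⁺ i} (inj₂ tt) ∷ hs))
    where
    F⁺ = F ⊎ᶠ pointFrame
    V⁺ : Atm → Frame.W F ⊎ ⊤ → Set
    V⁺ p = [ V p , (λ _ → ⊥) ]′
    point-witness : D5Witness F⁺ i (inj₂ tt) (inj₂ tt)
    point-witness _ (inj₂ _) = inj₂ tt

  sound : ∀ {D R Γ} → Der X D R Γ → Recorded D R → Sound D R Γ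
  sound (exch R↭R' Γ↭Γ' d) rec F fx V I wit hs =
    Any-resp-↭ Γ↭Γ' (sound d (Recorded-⊆ (∈-resp-↭ R'↭R) rec) F fx V I wit (All-resp-↭ R'↭R hs))
    where R'↭R = ↭-sym R↭R'
  sound (id {x = x} {p = p}) rec F fx V I wit hs with em {V p (I x)}
  ... | yes Vp = here Vp
  ... | no ¬Vp = there (here ¬Vp)
  sound (∨R d) rec F fx V I wit hs with sound d rec F fx V I wit hs
  ... | here f = here (inj₁ f)
  ... | there (here g) = here (inj₂ g)
  ... | there (there γ) = there γ
  sound (∧R d e) rec F fx V I wit hs with sound d rec F fx V I wit hs | sound e rec F fx V I wit hs
  ... | here f | here g = here (f , g)
  ... | there γ | _ = there γ
  ... | here _ | there γ = there γ
  sound (□R fresh d) rec =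
    box-sound Frame.RB rBox (λ r → r) (λ h → h) fresh rec (sound d (Recorded-⊆ there rec))
  sound ([]R {i = i} fresh d) rec =
    box-sound (λ F → Frame.RA F i) (rAg i) (λ r → r) (λ h → h) fresh rec
              (sound d (Recorded-⊆ there rec))
  sound (⊗R {i = i} fresh d) rec =
    box-sound (λ F → Frame.RO F i) (rOb i) (λ r → r) (λ h → h) fresh rec
              (sound d (Recorded-⊆ there rec))
  sound (◇R {y = y} p d) rec F fx V I wit hs =
    Any-absorb (λ f → I y , DiaPath⇒RB F (proj₁ fx) hs p , f) (sound d rec F fx V I wit hs)
  sound (⟨⟩R {y = y} p d) rec F fx V I wit hs =
    Any-absorb (λ f → I y , AgPath⇒RA F (proj₁ fx) hs p , f) (sound d rec F fx V I wit hs)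
  sound (⊖R {y = y} d) rec F fx V I wit (h ∷ hs) =
    Any-absorb (λ f → I y , h , f) (sound d rec F fx V I wit (h ∷ hs))
  sound (IOA {y = y} xs fresh chain d) rec F fx V I wit hs =
    update-fresh F fresh rec
      (λ wit' hs' → sound d (Recorded-⊆ (∈-++⁺ʳ _) rec) F fx V (update I y v) wit'
                      (++⁺ new-atoms hs'))
      wit hs
    where
    step : ∀ i → Frame.RB F (I (xs (inject₁ i))) (I (xs (fsuc i)))
    step i = DiaPath⇒RB F (proj₁ fx) hs
               (chain (inject₁ i) (fsuc i) (cong suc (sym (toℕ-inject₁ i))))
    meet = chain-meet (proj₁ fx) (I ∘ xs) step
    v = proj₁ meet
    new-atoms : All (holds F (update I y v)) (tabulate λ i → rAg i (xs i) y)
    new-atoms = tabulate⁺ {f = λ i → rAg i (xs i) y} λ i →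
      update-rel-reflexive {Rel = Frame.RA F i} (IsEquiv.refl (IsDS.C2a (proj₁ fx) i)) (proj₂ meet i)
  sound (D1R {i = i} p d) rec F fx V I wit (h ∷ hs) =
    sound d (Recorded-⊆ (∷⁺ʳ _ (xs⊆x∷xs _ _)) rec) F fx V I wit
      (h ∷ IsDS.D1 (proj₁ fx) i (DiaPath⇒RB F (proj₁ fx) hs p) h ∷ hs)
  sound (D3R {i = i} t d) rec F fx V I wit (h ∷ hs) =
    sound d (Recorded-⊆ (∷⁺ʳ _ (xs⊆x∷xs _ _)) rec) F fx V I wit
      (h ∷ proj₂ fx D3 t i h ∷ hs)
  sound (D4R {i = i} t p d) rec F fx V I wit (h ∷ hs) =
    sound d (Recorded-⊆ (∷⁺ʳ _ (xs⊆x∷xs _ _)) rec) F fx V I wit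
      (h ∷ proj₂ fx D4 t i h (AgPath⇒RA F (proj₁ fx) hs p) ∷ hs)
  sound (D5²R {z = z} t mem p d) rec F fx V I wit hs =
    sound d (Recorded-⊆ there rec) F fx V I wit
      (wit mem (I z) (AgPath⇒RA F (proj₁ fx) hs p) ∷ hs)
  sound (D2R {x = x} {y} {i} t fresh d) rec with x ≟ y
  ... | yes refl = point-successor fresh rec λ F fx V I wit →
    sound d (Recorded-⊆ there rec) F fx V I (wit ∘ there)
  ... | no x≢y = λ F fx V I →
    let v , r = proj₂ fx D2 t i (I x) in
    update-fresh F fresh rec λ wit hs →
      sound d (Recorded-⊆ there rec) F fx V (update I y v) wit
        (update-rel {Rel = Frame.RO F i} x≢y r ∷ hs)
  sound (D5¹R {x = x} {y} {i} t fresh d) rec with x ≟ y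
  ... | yes refl = point-successor fresh rec (sound d (Recorded-∷ rec))
  ... | no x≢y = λ F fx V I →
    let v , r , closed = proj₂ fx D5 t i (I x) in
    update-fresh F fresh rec λ wit hs →
      sound d (Recorded-∷ rec) F fx V (update I y v)
        (Witnesses-∷ F (update-rel {Rel = D5Witness F i} x≢y closed) wit)
        (update-rel {Rel = Frame.RO F i} x≢y r ∷ hs)

theoremA1 : ExcludedMiddle 0ℓ →
    (m : ℕ) (X : Ext → Bool) (R : List (RelAtom (suc m))) (Γ : List (LFm (suc m))) →
    Derivable X R Γ → Valid X R Γ
theoremA1 em m X R Γ d F fx V I = Soundness.sound em X d (λ ()) F fx V I (λ ())
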